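{- Let $p$ be a prime, $k$ a positive integer, $\gamma_1,\gamma_2$ $p^k$-symbols and $t,s$ integers with $\mathrm{sym}_{p^k}(t)=\mathrm{sym}_{p^k}(s)$. Then $|S^t_{p^k}(\gamma_1,\gamma_2)|=|S^s_{p^k}(\gamma_1,\gamma_2)|$.
   Context: $\mathrm{ord}_p(a)$ is the largest $e$ with $p^e\mid a$ ($\mathrm{ord}_p(0)=\infty$); $\mathrm{cop}_p(a)=a/p^{\mathrm{ord}_p(a)}$. $\mathrm{sgn}_p(0)=0$; for $a\ne0$, $\mathrm{sgn}_p(a)=\left(\frac{\mathrm{cop}_p(a)}{p}\right)$ (Legendre symbol) if $p$ odd and $\mathrm{cop}_2(a)\bmod 8$ if $p=2$. $\mathrm{sym}_{p^k}(t)=(\mathrm{ord}_p(t\bmod p^k),\mathrm{sgn}_p(t\bmod p^k))$ with $t\bmod p^k\in\{0,\dots,p^k-1\}$; a $p^k$-symbol is any value of $\mathrm{sym}_{p^k}$. For an integer $t$, $S^t_{p^k}(\gamma_1,\gamma_2)=\{(a,b)\in(\mathbb{Z}/p^k\mathbb{Z})^2:\mathrm{sym}_{p^k}(a)=\gamma_1,\ \mathrm{sym}_{p^k}(b)=\gamma_2,\ a+b\equiv t\pmod{p^k}\}$. -}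

module Defs where

open import Data.Bool using (Bool; true; false; if_then_else_)
open import Data.Nat as ℕ using (ℕ; zero; suc; _^_; _≡ᵇ_)
open import Data.Nat.DivMod using (_/_; _%_)
open import Data.Integer as ℤ using (ℤ; +_; -[1+_]; _%ℕ_)
open import Data.List using (List; length; filter; upTo; cartesianProduct)
open import Data.Bool.ListAction using (any)
open import Data.Product.Properties using (≡-dec)
open import Relation.Nullary using (Dec; yes; no; _×-dec_)
open import Relation.Nullary.Decidable using (map′)
open import Relation.Binary.Definitions using (DecidableEquality)
open import Relation.Binary.PropositionalEquality using (refl; cong)
open import Data.Product using (_×_; _,_; ∃)
open import Relation.Binary.PropositionalEquality using (_≡_)

-- ℕ extended with ∞ (value set of ord_p; ord_p(0) = ∞)
data ℕ∞ : Set where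
  fin : ℕ → ℕ∞
  ∞   : ℕ∞

-- Auxiliary recursion (p = suc q), with fuel: number of times p divides a.
ordAux : (fuel q a : ℕ) → ℕ
ordAux zero    q a = zero
ordAux (suc f) q a =
  if (a % suc q) ≡ᵇ 0 then suc (ordAux f q (a / suc q)) else zero

copAux : (fuel q a : ℕ) → ℕ
copAux zero    q a = a
copAux (suc f) q a =
  if (a % suc q) ≡ᵇ 0 then copAux f q (a / suc q) else a

-- ord_p(a) for a natural number a (fuel a suffices for p ≥ 2, a ≠ 0).
ord : (p a : ℕ) → ℕ∞
ord p       zero    = ∞
ord zero    (suc a) = fin 0        -- p = 0 never occurs (p prime)
ord (suc q) (suc a) = fin (ordAux (suc a) q (suc a))

cop : (p a : ℕ) → ℕ
cop zero    a = a                  -- p = 0 never occurs (p prime)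
cop (suc q) a = copAux a q a

isSquareMod : (p a : ℕ) → Bool
isSquareMod zero    a = false      -- p = 0 never occurs
isSquareMod (suc q) a =
  any (λ x → ((x ℕ.* x) % suc q) ≡ᵇ (a % suc q)) (upTo (suc q))

legendre : (a p : ℕ) → ℤ
legendre a zero    = + 0
legendre a (suc q) =
  if (a % suc q) ≡ᵇ 0 then + 0
  else (if isSquareMod (suc q) a then + 1 else -[1+ 0 ])

sgn : (p a : ℕ) → ℤ
sgn p zero    = + 0
sgn p (suc a) =
  if p ≡ᵇ 2 then + (cop p (suc a) % 8) else legendre (cop p (suc a)) p

Symbol : Set
Symbol = ℕ∞ × ℤ

-- t mod m ∈ {0,…,m-1} for integer t (m = 0 never occurs, m = p^k)
modℤ : ℤ → ℕ → ℕ
modℤ t zero    = 0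
modℤ t (suc m) = t %ℕ suc m

sym : (p k : ℕ) → ℤ → Symbol
sym p k t = ord p (modℤ t (p ^ k)) , sgn p (modℤ t (p ^ k))

IsSymbol : (p k : ℕ) → Symbol → Set
IsSymbol p k γ = ∃ λ (t : ℤ) → sym p k t ≡ γ

InS : (p k : ℕ) (t : ℤ) (γ₁ γ₂ : Symbol) → ℕ × ℕ → Set
InS p k t γ₁ γ₂ (a , b) =
  sym p k (+ a) ≡ γ₁ × sym p k (+ b) ≡ γ₂ × modℤ (+ a ℤ.+ + b) (p ^ k) ≡ modℤ t (p ^ k)

_≟∞_ : DecidableEquality ℕ∞
fin m ≟∞ fin n with m ℕ.≟ n
... | yes refl = yes refl
... | no m≢n   = no λ { refl → m≢n refl }
fin m ≟∞ ∞     = no λ ()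
∞     ≟∞ fin n = no λ ()
∞     ≟∞ ∞     = yes refl

_≟S_ : DecidableEquality Symbol
_≟S_ = ≡-dec _≟∞_ ℤ._≟_

InS? : (p k : ℕ) (t : ℤ) (γ₁ γ₂ : Symbol) (ab : ℕ × ℕ) → Dec (InS p k t γ₁ γ₂ ab)
InS? p k t γ₁ γ₂ (a , b) =
  (sym p k (+ a) ≟S γ₁) ×-dec ((sym p k (+ b) ≟S γ₂) ×-dec
     (modℤ (+ a ℤ.+ + b) (p ^ k) ℕ.≟ modℤ t (p ^ k)))

cardS : (p k : ℕ) (t : ℤ) (γ₁ γ₂ : Symbol) → ℕ
cardS p k t γ₁ γ₂ =
  length (filter (InS? p k t γ₁ γ₂) (cartesianProduct (upTo (p ^ k)) (upTo (p ^ k))))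

module Submission where

-- If sym(t) = sym(s), then s ≡ c·t (mod p^k) for a unit c that is ≡ 1 (mod 8) when p = 2 and a
-- square mod p when p is odd, and multiplication by such a c preserves every p^k-symbol; so
-- (a, b) ↦ (c·a, c·b) maps S^t bijectively onto S^s. For odd p the multiplier exists because two
-- nonsquares differ by a square factor: for a nonsquare a, the p − 1 residues 1², …, h², a·1², …, a·h²
-- (h = (p − 1)/2) are distinct units, so every nonsquare is among the a·z².

open import Data.Bool using (Bool; true; false; T; if_then_else_)
open import Data.Bool.ListAction using (any)
open import Data.Empty using (⊥-elim)
open import Data.Fin using (Fin; toℕ; fromℕ<; punchOut; splitAt; join)
open import Data.Fin.Properties
  using (toℕ<n; toℕ-fromℕ<; toℕ-injective; any?; punchOut-injective; injective⇒≤; join-splitAt)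
open import Data.Integer as ℤ using (ℤ; -[1+_])
import Data.Integer.Properties as ℤ
open import Data.Integer.DivMod using (n%ℕd<d)
open import Data.List using (List; []; _∷_; length; filter; map; upTo; cartesianProduct)
open import Data.List.Membership.Propositional using (_∈_; lose)
open import Data.List.Membership.Propositional.Properties
  using (∈-map⁺; ∈-map⁻; ∈-upTo⁺; ∈-upTo⁻; ∈-cartesianProduct⁺; ∈-cartesianProduct⁻)
open import Data.List.Membership.Propositional.Properties.WithK using (unique∧set⇒bag)
open import Data.List.Relation.Binary.BagAndSetEquality using (∼bag⇒↭)
open import Data.List.Relation.Binary.Permutation.Propositional using (_↭_)
open import Data.List.Relation.Binary.Permutation.Propositional.Properties using (filter-↭; ↭-length)
open import Data.List.Relation.Unary.Any using (here; there; satisfied)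
open import Data.List.Relation.Unary.Any.Properties using (any⁺; any⁻)
open import Data.List.Relation.Unary.Unique.Propositional using (Unique)
import Data.List.Relation.Unary.Unique.Propositional.Properties as Unique
open import Data.Nat
open import Data.Nat.Coprimality using (Coprime; coprime-Bézout; coprime-divisor)
open import Data.Nat.DivMod
open import Data.Nat.Divisibility
open import Data.Nat.Induction using (Acc; acc; <-wellFounded)
import Data.Nat.GCD as GCD
open import Data.Nat.Primality using (Prime; prime⇒irreducible; euclidsLemma; prime⇒nonZero; prime⇒nonTrivial)
open import Data.Nat.Properties
open import Data.Nat.Tactic.RingSolver using (solve-∀)
open import Data.Product using (_×_; _,_; proj₁; proj₂; ∃; ∃₂)
import Data.Product as Product
open import Data.Sum using (_⊎_; inj₁; inj₂)
open import Function using (_∘_; _⇔_; mk⇔; Equivalence; Injective)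
open import Relation.Nullary using (¬_; yes; no; Dec)
open import Relation.Nullary.Decidable using (T?)
import Relation.Nullary.Decidable as Dec
open import Relation.Unary using (Decidable)
open import Relation.Binary.PropositionalEquality hiding (sym)
import Relation.Binary.PropositionalEquality as ≡
open import Defs

private
  variable
    a b c d m : ℕ

module _ (m : ℕ) .{{_ : NonZero m}} where

  %-cong-* : a % m ≡ b % m → c % m ≡ d % m → (a * c) % m ≡ (b * d) % m
  %-cong-* {a} {b} {c} {d} a≡b c≡d = begin
    (a * c) % m             ≡⟨ %-distribˡ-* a c m ⟩
    ((a % m) * (c % m)) % m ≡⟨ cong₂ (λ x y → (x * y) % m) a≡b c≡d ⟩
    ((b % m) * (d % m)) % m ≡⟨ %-distribˡ-* b d m ⟨
    (b * d) % m             ∎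
    where open ≡-Reasoning

  %-cong-+ : a % m ≡ b % m → c % m ≡ d % m → (a + c) % m ≡ (b + d) % m
  %-cong-+ {a} {b} {c} {d} a≡b c≡d = begin
    (a + c) % m             ≡⟨ %-distribˡ-+ a c m ⟩
    ((a % m) + (c % m)) % m ≡⟨ cong₂ (λ x y → (x + y) % m) a≡b c≡d ⟩
    ((b % m) + (d % m)) % m ≡⟨ %-distribˡ-+ b d m ⟨
    (b + d) % m             ∎
    where open ≡-Reasoning

  %-cong-*ˡ : ∀ c → a % m ≡ b % m → (c * a) % m ≡ (c * b) % m
  %-cong-*ˡ c = %-cong-* {a = c} {b = c} refl

  %-cong-*ʳ : ∀ c → a % m ≡ b % m → (a * c) % m ≡ (b * c) % m
  %-cong-*ʳ c a≡b = %-cong-* {c = c} {d = c} a≡b refl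

  %-≡⇒∣∸ : a % m ≡ b % m → b ≤ a → m ∣ a ∸ b
  %-≡⇒∣∸ {a} {b} a≡b b≤a = divides (a / m ∸ b / m) (begin
    a ∸ b                                           ≡⟨ cong₂ _∸_ (m≡m%n+[m/n]*n a m) (m≡m%n+[m/n]*n b m) ⟩
    (a % m + (a / m) * m) ∸ (b % m + (b / m) * m)   ≡⟨ cong (λ x → (x + (a / m) * m) ∸ (b % m + (b / m) * m)) a≡b ⟩
    (b % m + (a / m) * m) ∸ (b % m + (b / m) * m)   ≡⟨ [m+n]∸[m+o]≡n∸o (b % m) _ _ ⟩
    (a / m) * m ∸ (b / m) * m                       ≡⟨ *-distribʳ-∸ m (a / m) (b / m) ⟨
    (a / m ∸ b / m) * m                             ∎)
    where open ≡-Reasoning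

  coprime⇒inverse : Coprime a m → ∃ λ w → (a * w) % m ≡ 1 % m
  coprime⇒inverse {a} a⊥m with coprime-Bézout a⊥m
  ... | GCD.Bézout.+- x y eq = x , (begin
    (a * x) % m     ≡⟨ cong (_% m) (*-comm a x) ⟩
    (x * a) % m     ≡⟨ cong (_% m) eq ⟨
    (1 + y * m) % m ≡⟨ [m+kn]%n≡m%n 1 y m ⟩
    1 % m           ∎)
    where open ≡-Reasoning
  ... | GCD.Bézout.-+ x y eq = inverse-from m eq
    where
    -- n·x ≡ −x (mod 1 + n), and x·a ≡ −1 by the Bézout identity.
    inverse-from : ∀ m → .{{_ : NonZero m}} → 1 + x * a ≡ y * m → ∃ λ w → (a * w) % m ≡ 1 % m
    inverse-from (suc n) eq = n * x , (begin
      (a * (n * x)) % suc n                       ≡⟨ [m+kn]%n≡m%n (a * (n * x)) y (suc n) ⟨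
      (a * (n * x) + y * suc n) % suc n           ≡⟨ cong (λ z → (a * (n * x) + z) % suc n) eq ⟨
      (a * (n * x) + (1 + x * a)) % suc n         ≡⟨ cong (_% suc n) (rearrange a n x) ⟩
      (1 + (x * a) * suc n) % suc n               ≡⟨ [m+kn]%n≡m%n 1 (x * a) (suc n) ⟩
      1 % suc n                                   ∎)
      where
      open ≡-Reasoning
      rearrange : ∀ a n x → a * (n * x) + (1 + x * a) ≡ 1 + (x * a) * suc n
      rearrange = solve-∀

%-≡-∣ : .{{_ : NonZero d}} .{{_ : NonZero m}} → d ∣ m → a % m ≡ b % m → a % d ≡ b % d
%-≡-∣ {d} {m} {a} {b} d∣m a≡b = begin
  a % d     ≡⟨ m∣n⇒o%n%m≡o%m d m a d∣m ⟨
  a % m % d ≡⟨ cong (_% d) a≡b ⟩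
  b % m % d ≡⟨ m∣n⇒o%n%m≡o%m d m b d∣m ⟩
  b % d     ∎
  where open ≡-Reasoning

0%n≡0 : ∀ m .{{_ : NonZero m}} → 0 % m ≡ 0
0%n≡0 m = n∣m⇒m%n≡0 0 m (m ∣0)

%≢0⇒≢0 : .{{_ : NonZero m}} → a % m ≢ 0 → a ≢ 0
%≢0⇒≢0 {m} a%m≢0 refl = a%m≢0 (0%n≡0 m)

*-≢0 : a ≢ 0 → b ≢ 0 → a * b ≢ 0
*-≢0 {a} a≢0 b≢0 ab≡0 with m*n≡0⇒m≡0∨n≡0 a ab≡0
... | inj₁ a≡0 = a≢0 a≡0
... | inj₂ b≡0 = b≢0 b≡0

^-≢0 : ∀ p .{{_ : NonZero p}} e → p ^ e ≢ 0
^-≢0 p e = ≢-nonZero⁻¹ (p ^ e) {{m^n≢0 p e}}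

^-monoʳ-∣ : ∀ m {i j} → i ≤ j → m ^ i ∣ m ^ j
^-monoʳ-∣ m {i} {j} i≤j = divides (m ^ (j ∸ i)) (begin
  m ^ j                 ≡⟨ cong (m ^_) (m+[n∸m]≡n i≤j) ⟨
  m ^ (i + (j ∸ i))     ≡⟨ ^-distribˡ-+-* m i (j ∸ i) ⟩
  m ^ i * m ^ (j ∸ i)   ≡⟨ *-comm (m ^ i) _ ⟩
  m ^ (j ∸ i) * m ^ i   ∎)
  where open ≡-Reasoning

difference-of-squares : ∀ {x y} → y ≤ x → x * x ≡ y * y + (x ∸ y) * (x + y)
difference-of-squares {x} {y} y≤x = begin
  x * x                        ≡⟨ cong (λ t → t * t) x≡y+δ ⟩
  (y + δ) * (y + δ)            ≡⟨ expand y δ ⟩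
  y * y + δ * ((y + δ) + y)    ≡⟨ cong (λ t → y * y + δ * (t + y)) x≡y+δ ⟨
  y * y + δ * (x + y)          ∎
  where
  open ≡-Reasoning
  δ : ℕ
  δ = x ∸ y
  x≡y+δ : x ≡ y + δ
  x≡y+δ = ≡.sym (m+[n∸m]≡n y≤x)
  expand : ∀ y d → (y + d) * (y + d) ≡ y * y + d * ((y + d) + y)
  expand = solve-∀

module _ {A : Set} {P Q : A → Set} (P? : Decidable P) (Q? : Decidable Q) where

  length-filter-map : (F : A → A) (xs : List A) → (∀ {x} → x ∈ xs → P x ⇔ Q (F x)) →
                      length (filter P? xs) ≡ length (filter Q? (map F xs))
  length-filter-map F [] P⇔Q = refl
  length-filter-map F (x ∷ xs) P⇔Q with P? x | Q? (F x)
  ... | yes _  | yes _   = cong suc (length-filter-map F xs (P⇔Q ∘ there))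
  ... | yes px | no ¬qFx = ⊥-elim (¬qFx (Equivalence.to (P⇔Q (here refl)) px))
  ... | no ¬px | yes qFx = ⊥-elim (¬px (Equivalence.from (P⇔Q (here refl)) qFx))
  ... | no _   | no _    = length-filter-map F xs (P⇔Q ∘ there)

  length-filter-bijection : (xs : List A) → Unique xs → (F G : A → A) →
    (∀ x → G (F x) ≡ x) → (∀ x → F (G x) ≡ x) →
    (∀ {x} → x ∈ xs → F x ∈ xs) → (∀ {x} → x ∈ xs → G x ∈ xs) →
    (∀ {x} → x ∈ xs → P x ⇔ Q (F x)) →
    length (filter P? xs) ≡ length (filter Q? xs)
  length-filter-bijection xs xs! F G G∘F F∘G F-closed G-closed P⇔Q =
    trans (length-filter-map F xs P⇔Q) (↭-length (filter-↭ Q? Fxs↭xs))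
    where
    F-injective : ∀ {x y} → F x ≡ F y → x ≡ y
    F-injective {x} {y} e = trans (≡.sym (G∘F x)) (trans (cong G e) (G∘F y))
    onto : ∀ {y} → y ∈ map F xs → y ∈ xs
    onto y∈ with ∈-map⁻ F y∈
    ... | x , x∈ , refl = F-closed x∈
    into : ∀ {y} → y ∈ xs → y ∈ map F xs
    into {y} y∈ = subst (_∈ map F xs) (F∘G y) (∈-map⁺ F (G-closed y∈))
    Fxs↭xs : map F xs ↭ xs
    Fxs↭xs = ∼bag⇒↭ (unique∧set⇒bag (Unique.map⁺ F-injective xs!) xs! (mk⇔ onto into))

injective⇒surjective : ∀ {n} (f : Fin n → Fin n) → Injective _≡_ _≡_ f → ∀ y → ∃ λ i → f i ≡ y
injective⇒surjective {suc n} f f-inj y with any? (λ i → f i Data.Fin.≟ y)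
... | yes hit = hit
... | no miss = ⊥-elim (<-irrefl refl (injective⇒≤ {f = f-avoiding-y} f-avoiding-y-injective))
  where
  f-avoiding-y : Fin (suc n) → Fin n
  f-avoiding-y i = punchOut {i = y} (λ e → miss (i , ≡.sym e))
  f-avoiding-y-injective : Injective _≡_ _≡_ f-avoiding-y
  f-avoiding-y-injective {i} {j} e =
    f-inj (punchOut-injective (λ e → miss (i , ≡.sym e)) (λ e → miss (j , ≡.sym e)) e)

T-⇔⇒≡ : ∀ {x y} → T x ⇔ T y → x ≡ y
T-⇔⇒≡ {false} {false} _ = refl
T-⇔⇒≡ {false} {true}  h = ⊥-elim (Equivalence.from h _)
T-⇔⇒≡ {true}  {false} h = ⊥-elim (Equivalence.to h _)
T-⇔⇒≡ {true}  {true}  _ = refl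

SquareMod : (p : ℕ) .{{_ : NonZero p}} → ℕ → Set
SquareMod p a = ∃ λ x → (x * x) % p ≡ a % p

T-isSquareMod : ∀ p .{{_ : NonZero p}} a → T (isSquareMod p a) ⇔ SquareMod p a
T-isSquareMod (suc q) a = mk⇔ to from
  where
  to : T (isSquareMod (suc q) a) → SquareMod (suc q) a
  to t with x , x²≡a ← satisfied (any⁻ _ (upTo (suc q)) t) = x , ≡ᵇ⇒≡ _ _ x²≡a
  from : SquareMod (suc q) a → T (isSquareMod (suc q) a)
  from (x , x²≡a) = any⁺ _ (lose (∈-upTo⁺ (m%n<n x (suc q)))
    (≡⇒≡ᵇ _ _ (trans (≡.sym (%-distribˡ-* x x (suc q))) x²≡a)))

squareMod? : ∀ p .{{_ : NonZero p}} a → Dec (SquareMod p a)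
squareMod? p a = Dec.map (T-isSquareMod p a) (T? _)

±1 : Bool → ℤ
±1 b = if b then ℤ.+ 1 else -[1+ 0 ]

±1-injective : ∀ {x y} → ±1 x ≡ ±1 y → x ≡ y
±1-injective {false} {false} _ = refl
±1-injective {true}  {true}  _ = refl

legendre-unit : ∀ p .{{_ : NonZero p}} {a} → a % p ≢ 0 → legendre a p ≡ ±1 (isSquareMod p a)
legendre-unit (suc q) {a} a≢0 with (a % suc q) ≡ᵇ 0 in eq
... | true  = ⊥-elim (a≢0 (≡ᵇ⇒≡ _ _ (subst T (≡.sym eq) _)))
... | false = refl

legendre-cong : ∀ p .{{_ : NonZero p}} {a b} → a % p ≡ b % p → legendre a p ≡ legendre b p
legendre-cong (suc q) = cong λ r →
  if r ≡ᵇ 0 then ℤ.+ 0 else ±1 (any (λ x → ((x * x) % suc q) ≡ᵇ r) (upTo (suc q)))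

legendre-≡⇔ : ∀ p .{{_ : NonZero p}} {a b} → a % p ≢ 0 → b % p ≢ 0 →
              legendre a p ≡ legendre b p ⇔ (SquareMod p a ⇔ SquareMod p b)
legendre-≡⇔ p {a} {b} a≢0 b≢0 = mk⇔ to from
  where
  module A = Equivalence (T-isSquareMod p a)
  module B = Equivalence (T-isSquareMod p b)
  to : legendre a p ≡ legendre b p → SquareMod p a ⇔ SquareMod p b
  to e with ±1-injective (trans (≡.sym (legendre-unit p a≢0)) (trans e (legendre-unit p b≢0)))
  ... | sa≡sb = mk⇔ (λ sq → B.to (subst T sa≡sb (A.from sq))) (λ sq → A.to (subst T (≡.sym sa≡sb) (B.from sq)))
  from : SquareMod p a ⇔ SquareMod p b → legendre a p ≡ legendre b p
  from h = trans (legendre-unit p a≢0) (trans (cong ±1 sa≡sb) (≡.sym (legendre-unit p b≢0)))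
    where
    sa≡sb : isSquareMod p a ≡ isSquareMod p b
    sa≡sb = T-⇔⇒≡ (mk⇔ (λ t → B.from (Equivalence.to h (A.to t))) (λ t → A.from (Equivalence.from h (B.to t))))

ordAux-copAux : ∀ {q} → 0 < q → ∀ e {y} fuel → y % suc q ≢ 0 → suc q ^ e * y ≤ fuel →
                ordAux fuel q (suc q ^ e * y) ≡ e × copAux fuel q (suc q ^ e * y) ≡ y
ordAux-copAux {q} _ e zero y%p≢0 x≤0 =
  ⊥-elim (*-≢0 (^-≢0 (suc q) e) (%≢0⇒≢0 y%p≢0) (n≤0⇒n≡0 x≤0))
ordAux-copAux {q} _ zero {y} (suc f) y%p≢0 _ with (suc q ^ zero * y) % suc q ≡ᵇ 0 in eq
... | true  = ⊥-elim (y%p≢0 (trans (cong (_% suc q) (≡.sym (*-identityˡ y))) (≡ᵇ⇒≡ _ _ (subst T (≡.sym eq) _))))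
... | false = refl , *-identityˡ y
ordAux-copAux {q} 0<q (suc e) {y} (suc f) y%p≢0 x≤1+f = goal
  where
  z : ℕ
  z = suc q ^ e * y
  x≡z*p : suc q ^ suc e * y ≡ z * suc q
  x≡z*p = trans (*-assoc (suc q) (suc q ^ e) y) (*-comm (suc q) z)
  x%p≡0 : (suc q ^ suc e * y) % suc q ≡ 0
  x%p≡0 = trans (cong (_% suc q) x≡z*p) (m*n%n≡0 z (suc q))
  x/p≡z : (suc q ^ suc e * y) / suc q ≡ z
  x/p≡z = trans (cong (_/ suc q) x≡z*p) (m*n/n≡m z (suc q))
  z≢0 : z ≢ 0
  z≢0 = *-≢0 (^-≢0 (suc q) e) (%≢0⇒≢0 y%p≢0)
  z≤f : z ≤ f
  z≤f = ≤-pred (≤-trans (subst (z <_) (≡.sym x≡z*p) (m<m*n z (suc q) {{≢-nonZero z≢0}} (s≤s 0<q))) x≤1+f)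
  goal : ordAux (suc f) q (suc q ^ suc e * y) ≡ suc e × copAux (suc f) q (suc q ^ suc e * y) ≡ y
  goal rewrite x%p≡0 | x/p≡z = let ord≡ , cop≡ = ordAux-copAux 0<q e f y%p≢0 z≤f in cong suc ord≡ , cop≡

ord-cop-p^e*y : ∀ p .{{_ : NonZero p}} → 1 < p → ∀ e {y} → y % p ≢ 0 →
                ord p (p ^ e * y) ≡ fin e × cop p (p ^ e * y) ≡ y
ord-cop-p^e*y (suc q) (s≤s 0<q) e {y} y%p≢0
  with suc q ^ e * y in x≡ | *-≢0 {b = y} (^-≢0 (suc q) e) (%≢0⇒≢0 y%p≢0)
... | zero  | x≢0 = ⊥-elim (x≢0 refl)
... | suc x | _ =
  let ord≡ , cop≡ = subst (λ n → ordAux n q n ≡ e × copAux n q n ≡ y) x≡ (ordAux-copAux 0<q e _ y%p≢0 ≤-refl)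
  in cong fin ord≡ , cop≡

unitSign : ℕ → ℕ → ℤ
unitSign p y = if p ≡ᵇ 2 then ℤ.+ (y % 8) else legendre y p

symbolℕ : ℕ → ℕ → Symbol
symbolℕ p x = ord p x , sgn p x

symbolℕ-p^e*y : ∀ p .{{_ : NonZero p}} → 1 < p → ∀ e {y} → y % p ≢ 0 →
                symbolℕ p (p ^ e * y) ≡ (fin e , unitSign p y)
symbolℕ-p^e*y p 1<p e {y} y%p≢0 with ord-cop-p^e*y p 1<p e y%p≢0
... | ord≡ , cop≡ =
  cong₂ _,_ ord≡ (trans (sgn-cop (*-≢0 (^-≢0 p e) (%≢0⇒≢0 y%p≢0))) (cong (unitSign p) cop≡))
  where
  sgn-cop : ∀ {x} → x ≢ 0 → sgn p x ≡ unitSign p (cop p x)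
  sgn-cop {zero}  x≢0 = ⊥-elim (x≢0 refl)
  sgn-cop {suc x} _   = refl

unitSign-2 : ∀ {p} → p ≡ 2 → unitSign p a ≡ ℤ.+ (a % 8)
unitSign-2 refl = refl

unitSign-odd : ∀ {p} → p ≢ 2 → unitSign p a ≡ legendre a p
unitSign-odd {a} {p} p≢2 with p ≡ᵇ 2 in eq
... | true  = ⊥-elim (p≢2 (≡ᵇ⇒≡ p 2 (subst T (≡.sym eq) _)))
... | false = refl

fin-injective : fin a ≡ fin b → a ≡ b
fin-injective refl = refl

ord≡∞⇒≡0 : ∀ p x → ord p x ≡ ∞ → x ≡ 0
ord≡∞⇒≡0 p       zero    _ = refl
ord≡∞⇒≡0 zero    (suc x) ()
ord≡∞⇒≡0 (suc q) (suc x) ()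

modℤ< : ∀ t n .{{_ : NonZero n}} → modℤ t n < n
modℤ< t (suc n) = n%ℕd<d t (suc n)

modℤ-+ : ∀ a n .{{_ : NonZero n}} → modℤ (ℤ.+ a) n ≡ a % n
modℤ-+ a (suc n) = refl

module Units (p : ℕ) (p-prime : Prime p) where

  instance
    p-nonZero : NonZero p
    p-nonZero = prime⇒nonZero p-prime

  1<p : 1 < p
  1<p = nonTrivial⇒n>1 p {{prime⇒nonTrivial p-prime}}

  Unit : ℕ → Set
  Unit a = a % p ≢ 0

  unit⇒∤ : Unit a → ¬ (p ∣ a)
  unit⇒∤ {a} a-unit p∣a = a-unit (n∣m⇒m%n≡0 a p p∣a)

  unit-* : Unit a → Unit b → Unit (a * b)
  unit-* {a} {b} a-unit b-unit ab%p≡0 with euclidsLemma a b p-prime (m%n≡0⇒n∣m (a * b) p ab%p≡0)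
  ... | inj₁ p∣a = unit⇒∤ a-unit p∣a
  ... | inj₂ p∣b = unit⇒∤ b-unit p∣b

  unit-*ˡ : Unit (a * b) → Unit a
  unit-*ˡ {a} {b} ab-unit a%p≡0 = unit⇒∤ ab-unit (∣m⇒∣m*n b (m%n≡0⇒n∣m a p a%p≡0))

  unit-*ʳ : Unit (a * b) → Unit b
  unit-*ʳ {a} {b} ab-unit b%p≡0 = unit⇒∤ ab-unit (∣n⇒∣m*n a (m%n≡0⇒n∣m b p b%p≡0))

  unit-small : 0 < a → a < p → Unit a
  unit-small {a} 0<a a<p a%p≡0 = <⇒≢ 0<a (≡.sym (trans (≡.sym (m<n⇒m%n≡m a<p)) a%p≡0))

  unit-cong : a % p ≡ b % p → Unit a → Unit b
  unit-cong a≡b a-unit b%p≡0 = a-unit (trans a≡b b%p≡0)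

  unit-1 : Unit 1
  unit-1 = unit-small z<s 1<p

  coprime-p : Unit a → Coprime a p
  coprime-p a-unit (d∣a , d∣p) with prime⇒irreducible p-prime d∣p
  ... | inj₁ d≡1 = d≡1
  ... | inj₂ refl = ⊥-elim (unit⇒∤ a-unit d∣a)

  coprime-p^ : Unit a → ∀ j → Coprime a (p ^ j)
  coprime-p^ a-unit zero    (_ , d∣1) = ∣1⇒≡1 d∣1
  coprime-p^ a-unit (suc j) {d} (d∣a , d∣p*pʲ) = coprime-p^ a-unit j (d∣a , coprime-divisor d⊥p d∣p*pʲ)
    where
    d⊥p : Coprime d p
    d⊥p = λ (e∣d , e∣p) → coprime-p a-unit (∣-trans e∣d d∣a , e∣p)

  inverse-mod-p : Unit a → ∃ λ w → (a * w) % p ≡ 1 % p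
  inverse-mod-p a-unit = coprime⇒inverse p (coprime-p a-unit)

  module Modulus (j : ℕ) where
    instance
      p^-nonZero : NonZero (p ^ j)
      p^-nonZero = m^n≢0 p j

  module _ (j : ℕ) where
    open Modulus j

    inverse-mod-p^ : Unit a → ∃ λ w → (a * w) % p ^ j ≡ 1 % p ^ j
    inverse-mod-p^ a-unit = coprime⇒inverse (p ^ j) (coprime-p^ a-unit j)

  unit-cancel-*ˡ : Unit a → (a * b) % p ≡ (a * c) % p → b % p ≡ c % p
  unit-cancel-*ˡ {a} {b} {c} a-unit ab≡ac with w , aw≡1 ← inverse-mod-p a-unit = begin
    b % p                ≡⟨ cong (_% p) (*-identityˡ b) ⟨
    (1 * b) % p          ≡⟨ %-cong-*ʳ p b (≡.sym aw≡1) ⟩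
    ((a * w) * b) % p    ≡⟨ cong (_% p) (reorder a w b) ⟩
    (w * (a * b)) % p    ≡⟨ %-cong-*ˡ p w ab≡ac ⟩
    (w * (a * c)) % p    ≡⟨ cong (_% p) (reorder a w c) ⟨
    ((a * w) * c) % p    ≡⟨ %-cong-*ʳ p c aw≡1 ⟩
    (1 * c) % p          ≡⟨ cong (_% p) (*-identityˡ c) ⟩
    c % p                ∎
    where
    open ≡-Reasoning
    reorder : ∀ a w b → (a * w) * b ≡ w * (a * b)
    reorder = solve-∀

  square-scale : ∀ z → SquareMod p a → SquareMod p (z * z * a)
  square-scale {a} z (x , x²≡a) = z * x , trans (cong (_% p) (reorder z x)) (%-cong-*ˡ p (z * z) x²≡a)
    where
    reorder : ∀ z x → (z * x) * (z * x) ≡ (z * z) * (x * x)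
    reorder = solve-∀

  square-unscale : ∀ {z} → Unit z → SquareMod p (z * z * a) → SquareMod p a
  square-unscale {a} {z} z-unit (x , x²≡z²a) with w , zw≡1 ← inverse-mod-p z-unit = w * x , (begin
    ((w * x) * (w * x)) % p            ≡⟨ cong (_% p) (reorderˡ w x) ⟩
    ((w * w) * (x * x)) % p            ≡⟨ %-cong-*ˡ p (w * w) x²≡z²a ⟩
    ((w * w) * (z * z * a)) % p        ≡⟨ cong (_% p) (reorderʳ w z a) ⟩
    ((z * w) * (z * w) * a) % p        ≡⟨ %-cong-*ʳ p a (%-cong-* p zw≡1 zw≡1) ⟩
    (1 * 1 * a) % p                    ≡⟨ cong (_% p) (*-identityˡ a) ⟩
    a % p                              ∎)
    where
    open ≡-Reasoning
    reorderˡ : ∀ w x → (w * x) * (w * x) ≡ (w * w) * (x * x)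
    reorderˡ = solve-∀
    reorderʳ : ∀ w z a → (w * w) * (z * z * a) ≡ (z * w) * (z * w) * a
    reorderʳ = solve-∀

  square-* : ∀ {z} → Unit z → c % p ≡ (z * z) % p → SquareMod p (c * a) ⇔ SquareMod p a
  square-* {c} {a} {z} z-unit c≡z² = mk⇔
    (λ (x , e) → square-unscale z-unit (x , trans e c*a≡z²a))
    (λ sq → let (x , e) = square-scale z sq in x , trans e (≡.sym c*a≡z²a))
    where
    c*a≡z²a : (c * a) % p ≡ (z * z * a) % p
    c*a≡z²a = %-cong-*ʳ p a c≡z²

  square-ratio : Unit a → Unit b → SquareMod p a → SquareMod p b → ∃ λ z → Unit z × b % p ≡ (z * z * a) % p
  square-ratio {a} {b} a-unit b-unit (x , x²≡a) (y , y²≡b) = y * w , unit-* y-unit w-unit , (begin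
    b % p                               ≡⟨ y²≡b ⟨
    (y * y) % p                         ≡⟨ cong (_% p) (*-identityʳ (y * y)) ⟨
    (y * y * 1) % p                     ≡⟨ %-cong-*ˡ p (y * y) (%-cong-* p xw≡1 xw≡1) ⟨
    (y * y * ((x * w) * (x * w))) % p   ≡⟨ cong (_% p) (reorder y w x) ⟩
    ((y * w) * (y * w) * (x * x)) % p   ≡⟨ %-cong-*ˡ p ((y * w) * (y * w)) x²≡a ⟩
    ((y * w) * (y * w) * a) % p         ∎)
    where
    open ≡-Reasoning
    x-unit : Unit x
    x-unit = unit-*ˡ (unit-cong (≡.sym x²≡a) a-unit)
    y-unit : Unit y
    y-unit = unit-*ˡ (unit-cong (≡.sym y²≡b) b-unit)
    w : ℕ
    w = proj₁ (inverse-mod-p x-unit)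
    xw≡1 : (x * w) % p ≡ 1 % p
    xw≡1 = proj₂ (inverse-mod-p x-unit)
    w-unit : Unit w
    w-unit = unit-*ʳ {x} (unit-cong (≡.sym xw≡1) unit-1)
    reorder : ∀ y w x → y * y * ((x * w) * (x * w)) ≡ (y * w) * (y * w) * (x * x)
    reorder = solve-∀

  decompose : ∀ {x} → 0 < x → ∃₂ λ e y → x ≡ p ^ e * y × Unit y
  decompose = go (<-wellFounded _)
    where
    go : ∀ {x} → Acc _<_ x → 0 < x → ∃₂ λ e y → x ≡ p ^ e * y × Unit y
    go {x} (acc rec) 0<x with x % p ≟ 0
    ... | no x-unit = 0 , x , ≡.sym (*-identityˡ x) , x-unit
    ... | yes x%p≡0 = extend (go (rec x/p<x) 0<x/p)
      where
      x≡p*x/p : x ≡ p * (x / p)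
      x≡p*x/p = ≡.sym (m*[n/m]≡n (m%n≡0⇒n∣m x p x%p≡0))
      0<x/p : 0 < x / p
      0<x/p = n≢0⇒n>0 λ x/p≡0 → <⇒≢ 0<x (≡.sym (trans x≡p*x/p (trans (cong (p *_) x/p≡0) (*-zeroʳ p))))
      x/p<x : x / p < x
      x/p<x = m/n<m x p {{>-nonZero 0<x}} 1<p
      extend : (∃₂ λ e y → x / p ≡ p ^ e * y × Unit y) → ∃₂ λ e y → x ≡ p ^ e * y × Unit y
      extend (e , y , x/p≡ , y-unit) =
        suc e , y , trans x≡p*x/p (trans (cong (p *_) x/p≡) (≡.sym (*-assoc p (p ^ e) y))) , y-unit

module OddPrime (p : ℕ) (p-prime : Prime p) (p≢2 : p ≢ 2) where

  open Units p p-prime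

  h : ℕ
  h = p / 2

  p%2≡1 : p % 2 ≡ 1
  p%2≡1 with p % 2 in eq | m%n<n p 2
  ... | 0 | _ with prime⇒irreducible p-prime (m%n≡0⇒n∣m p 2 eq)
  ...   | inj₂ 2≡p = ⊥-elim (p≢2 (≡.sym 2≡p))
  p%2≡1 | 1 | _ = refl
  p%2≡1 | suc (suc _) | s≤s (s≤s ())

  p≡1+2h : p ≡ suc (h + h)
  p≡1+2h = trans (m≡m%n+[m/n]*n p 2) (cong₂ _+_ p%2≡1 (trans (*-comm h 2) (cong (h +_) (+-identityʳ h))))

  small-unit : ∀ {x} → 0 < x → x ≤ h + h → Unit x
  small-unit 0<x x≤2h = unit-small 0<x (subst (_ <_) (≡.sym p≡1+2h) (s≤s x≤2h))

  -- p divides x² − y² = (x − y)(x + y), and both factors are below p.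
  square-injective-≤ : ∀ {x y} → y ≤ x → 0 < x → x ≤ h → y ≤ h → (x * x) % p ≡ (y * y) % p → x ≡ y
  square-injective-≤ {x} {y} y≤x 0<x x≤h y≤h x²≡y²
    with euclidsLemma (x ∸ y) (x + y) p-prime p∣[x∸y][x+y]
    where
    p∣[x∸y][x+y] : p ∣ (x ∸ y) * (x + y)
    p∣[x∸y][x+y] = subst (p ∣_) (m+n∸m≡n (y * y) _)
      (%-≡⇒∣∸ p (trans (cong (_% p) (≡.sym (difference-of-squares y≤x))) x²≡y²) (m≤m+n (y * y) _))
  ... | inj₂ p∣x+y = ⊥-elim (unit⇒∤ (small-unit (<-≤-trans 0<x (m≤m+n x y)) (+-mono-≤ x≤h y≤h)) p∣x+y)
  ... | inj₁ p∣x∸y with x ∸ y in x∸y≡δ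
  ...   | zero  = ≤-antisym (m∸n≡0⇒m≤n x∸y≡δ) y≤x
  ...   | suc d = ⊥-elim (unit⇒∤ (small-unit z<s
                    (≤-trans (subst (_≤ x) x∸y≡δ (m∸n≤m x y)) (≤-trans x≤h (m≤m+n h h)))) p∣x∸y)

  square-injective : ∀ {x y} → 0 < x → x ≤ h → 0 < y → y ≤ h → (x * x) % p ≡ (y * y) % p → x ≡ y
  square-injective {x} {y} 0<x x≤h 0<y y≤h x²≡y² with ≤-total y x
  ... | inj₁ y≤x = square-injective-≤ y≤x 0<x x≤h y≤h x²≡y²
  ... | inj₂ x≤y = ≡.sym (square-injective-≤ x≤y 0<y y≤h x≤h (≡.sym x²≡y²))

  residue≤2h : ∀ n → n % p ≤ h + h
  residue≤2h n = ≤-pred (subst (n % p <_) p≡1+2h (m%n<n n p))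

  -- The nonzero residue n % p ∈ {1, …, 2h}, shifted down by one.
  residueIndex : ∀ n → Unit n → Fin (h + h)
  residueIndex n n-unit = fromℕ< (subst (_≤ h + h) (≡.sym (suc-pred (n % p) {{≢-nonZero n-unit}})) (residue≤2h n))

  residueIndex-injective : ∀ m n (m-unit : Unit m) (n-unit : Unit n) →
                           residueIndex m m-unit ≡ residueIndex n n-unit → m % p ≡ n % p
  residueIndex-injective m n m-unit n-unit e = pred-injective {{≢-nonZero m-unit}} {{≢-nonZero n-unit}}
    (trans (≡.sym (toℕ-fromℕ< _)) (trans (cong toℕ e) (toℕ-fromℕ< _)))

  module Nonsquare {a : ℕ} (a-unit : Unit a) (a-nonsquare : ¬ SquareMod p a) where

    root : Fin h → ℕ
    root i = suc (toℕ i)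

    root-unit : ∀ i → Unit (root i)
    root-unit i = small-unit z<s (≤-trans (toℕ<n i) (m≤m+n h h))

    element : Fin h ⊎ Fin h → ℕ
    element (inj₁ i) = root i * root i
    element (inj₂ i) = a * (root i * root i)

    element-unit : ∀ u → Unit (element u)
    element-unit (inj₁ i) = unit-* (root-unit i) (root-unit i)
    element-unit (inj₂ i) = unit-* a-unit (unit-* (root-unit i) (root-unit i))

    square≢a*square : ∀ i j → (root i * root i) % p ≢ (a * (root j * root j)) % p
    square≢a*square i j e = a-nonsquare (square-unscale (root-unit j) (root i , trans e (cong (_% p) (*-comm a _))))

    element-injective : ∀ u v → element u % p ≡ element v % p → u ≡ v
    element-injective (inj₁ i) (inj₁ j) e = cong inj₁ (toℕ-injective (suc-injective
      (square-injective z<s (toℕ<n i) z<s (toℕ<n j) e)))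
    element-injective (inj₂ i) (inj₂ j) e = cong inj₂ (toℕ-injective (suc-injective
      (square-injective z<s (toℕ<n i) z<s (toℕ<n j) (unit-cancel-*ˡ a-unit e))))
    element-injective (inj₁ i) (inj₂ j) e = ⊥-elim (square≢a*square i j e)
    element-injective (inj₂ i) (inj₁ j) e = ⊥-elim (square≢a*square j i (≡.sym e))

    listing : Fin (h + h) → Fin (h + h)
    listing i = residueIndex (element (splitAt h i)) (element-unit (splitAt h i))

    listing-injective : Injective _≡_ _≡_ listing
    listing-injective {i} {j} e = begin
      i                          ≡⟨ join-splitAt h h i ⟨
      join h h (splitAt h i)     ≡⟨ cong (join h h) (element-injective u v
                                      (residueIndex-injective (element u) (element v) (element-unit u) (element-unit v) e)) ⟩
      join h h (splitAt h j)     ≡⟨ join-splitAt h h j ⟩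
      j                          ∎
      where
      open ≡-Reasoning
      u v : Fin h ⊎ Fin h
      u = splitAt h i
      v = splitAt h j

    nonsquare-ratio : Unit b → ¬ SquareMod p b → ∃ λ z → Unit z × b % p ≡ (z * z * a) % p
    nonsquare-ratio {b} b-unit b-nonsquare
      with i , i↦b ← injective⇒surjective listing listing-injective (residueIndex b b-unit)
      = classify (splitAt h i) (residueIndex-injective _ b (element-unit (splitAt h i)) b-unit i↦b)
      where
      classify : ∀ u → element u % p ≡ b % p → ∃ λ z → Unit z × b % p ≡ (z * z * a) % p
      classify (inj₁ j) e = ⊥-elim (b-nonsquare (root j , e))
      classify (inj₂ j) e = root j , root-unit j , trans (≡.sym e) (cong (_% p) (*-comm a _))

  same-character⇒square-ratio : Unit a → Unit b → (SquareMod p a ⇔ SquareMod p b) →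
                                ∃ λ z → Unit z × b % p ≡ (z * z * a) % p
  same-character⇒square-ratio {a} a-unit b-unit a⇔b with squareMod? p a
  ... | yes a-square    = square-ratio a-unit b-unit a-square (Equivalence.to a⇔b a-square)
  ... | no a-nonsquare  =
    Nonsquare.nonsquare-ratio a-unit a-nonsquare b-unit (a-nonsquare ∘ Equivalence.from a⇔b)

module PrimePower (p : ℕ) (p-prime : Prime p) (k : ℕ) where

  open Units p p-prime
  open Modulus k

  record Split (x : ℕ) : Set where
    field
      e j y  : ℕ
      k≡e+j  : k ≡ e + j
      x≡     : x ≡ p ^ e * y
      y-unit : Unit y
      y<     : y < p ^ j
      0<j    : 0 < j

  split : ∀ {x} → 0 < x → x < p ^ k → Split x
  split {x} 0<x x< with e , y , x≡ , y-unit ← decompose 0<x = record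
    { e = e ; j = k ∸ e ; y = y ; k≡e+j = k≡e+j ; x≡ = x≡ ; y-unit = y-unit ; y< = y< ; 0<j = m<n⇒0<n∸m e<k }
    where
    0<y : 0 < y
    0<y = n≢0⇒n>0 (%≢0⇒≢0 y-unit)
    e<k : e < k
    e<k = ≰⇒> λ k≤e → <-irrefl refl (begin-strict
      p ^ k       ≤⟨ ^-monoʳ-≤ p k≤e ⟩
      p ^ e       ≤⟨ m≤m*n (p ^ e) y {{>-nonZero 0<y}} ⟩
      p ^ e * y   ≡⟨ x≡ ⟨
      x           <⟨ x< ⟩
      p ^ k       ∎)
      where open ≤-Reasoning
    k≡e+j : k ≡ e + (k ∸ e)
    k≡e+j = ≡.sym (m+[n∸m]≡n (<⇒≤ e<k))
    y< : y < p ^ (k ∸ e)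
    y< = *-cancelˡ-< (p ^ e) y (p ^ (k ∸ e))
           (subst₂ _<_ x≡ (trans (cong (p ^_) k≡e+j) (^-distribˡ-+-* p e (k ∸ e))) x<)

  module _ {e j : ℕ} (k≡e+j : k ≡ e + j) where
    open Modulus j

    *-%-p^e : ∀ c y → (c * (p ^ e * y)) % p ^ k ≡ p ^ e * ((c * y) % p ^ j)
    *-%-p^e c y = begin
      (c * (p ^ e * y)) % p ^ k               ≡⟨ cong (_% p ^ k) (reorder c (p ^ e) y) ⟩
      ((c * y) * p ^ e) % p ^ k               ≡⟨ %-congʳ {{_}} {{pʲ*pᵉ-nonZero}} pᵏ≡pʲ*pᵉ ⟩
      _%_ ((c * y) * p ^ e) (p ^ j * p ^ e) {{pʲ*pᵉ-nonZero}}
                                              ≡⟨ m%n*o≡m*o%[n*o] (c * y) (p ^ j) (p ^ e) {{_}} {{pʲ*pᵉ-nonZero}} ⟨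
      (c * y) % p ^ j * p ^ e                 ≡⟨ *-comm _ (p ^ e) ⟩
      p ^ e * ((c * y) % p ^ j)               ∎
      where
      open ≡-Reasoning
      reorder : ∀ c pᵉ y → c * (pᵉ * y) ≡ (c * y) * pᵉ
      reorder = solve-∀
      pʲ*pᵉ-nonZero : NonZero (p ^ j * p ^ e)
      pʲ*pᵉ-nonZero = m*n≢0 (p ^ j) (p ^ e) {{m^n≢0 p j}} {{m^n≢0 p e}}
      pᵏ≡pʲ*pᵉ : p ^ k ≡ p ^ j * p ^ e
      pᵏ≡pʲ*pᵉ = trans (cong (p ^_) k≡e+j) (trans (^-distribˡ-+-* p e j) (*-comm (p ^ e) (p ^ j)))

  -- The sign of a unit is its residue mod 8 when p = 2 and its Legendre symbol when p is odd;
  -- multiplying by such a c changes neither.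
  record SymbolPreserving (c : ℕ) : Set where
    field
      unit       : Unit c
      ≡1-mod-8   : p ≡ 2 → c % 8 ≡ 1
      square     : p ≢ 2 → ∃ λ z → Unit z × c % p ≡ (z * z) % p

  symbolPreserving-1 : SymbolPreserving 1
  symbolPreserving-1 = record { unit = unit-1 ; ≡1-mod-8 = λ _ → refl ; square = λ _ → 1 , unit-1 , refl }

  module _ (j : ℕ) where
    open Modulus j

    %-p^j-%-p : 0 < j → ∀ a → (a % p ^ j) % p ≡ a % p
    %-p^j-%-p 0<j a = m∣n⇒o%n%m≡o%m p (p ^ j) a (subst (_∣ p ^ j) (*-identityʳ p) (^-monoʳ-∣ p 0<j))

    unitSign-* : ∀ {y} → SymbolPreserving c → 0 < j → Unit y → y < p ^ j →
                 unitSign p ((c * y) % p ^ j) ≡ unitSign p y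
    unitSign-* {c} {y} c-pres 0<j y-unit y< with p ≟ 2
    ... | yes p≡2 = trans (unitSign-2 p≡2) (trans (cong ℤ.+_ [cy%pʲ]%8≡y%8) (≡.sym (unitSign-2 p≡2)))
      where
      cy%8≡y%8 : (c * y) % 8 ≡ y % 8
      cy%8≡y%8 = trans (%-cong-*ʳ 8 {a = c} {b = 1} y (SymbolPreserving.≡1-mod-8 c-pres p≡2))
                       (cong (_% 8) (*-identityˡ y))
      p³≡8 : p ^ 3 ≡ 8
      p³≡8 = cong (_^ 3) p≡2
      [cy%pʲ]%8≡y%8 : ((c * y) % p ^ j) % 8 ≡ y % 8
      [cy%pʲ]%8≡y%8 with 3 ≤? j
      ... | yes 3≤j = trans (m∣n⇒o%n%m≡o%m 8 (p ^ j) (c * y) (subst (_∣ p ^ j) p³≡8 (^-monoʳ-∣ p 3≤j))) cy%8≡y%8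
      ... | no  j≱3 = cong (_% 8) (trans
        (%-≡-∣ (subst (p ^ j ∣_) p³≡8 (^-monoʳ-∣ p (<⇒≤ (≰⇒> j≱3)))) cy%8≡y%8) (m<n⇒m%n≡m y<))
    ... | no p≢2 with z , z-unit , c≡z² ← SymbolPreserving.square c-pres p≢2 =
      trans (unitSign-odd p≢2) (trans legendre≡ (≡.sym (unitSign-odd p≢2)))
      where
      legendre≡ : legendre ((c * y) % p ^ j) p ≡ legendre y p
      legendre≡ = trans (legendre-cong p (%-p^j-%-p 0<j (c * y)))
        (Equivalence.from (legendre-≡⇔ p (unit-* (SymbolPreserving.unit c-pres) y-unit) y-unit)
                          (square-* z-unit c≡z²))

    quotient-mod-p^ : ∀ {u} → Unit u → ∀ v → ∃ λ c → (c * u) % p ^ j ≡ v % p ^ j ×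
      (∀ d .{{_ : NonZero d}} r → d ∣ p ^ j → v % d ≡ (r * u) % d → c % d ≡ r % d)
    quotient-mod-p^ {u} u-unit v = v * w , vw*u≡v , reduces
      where
      w : ℕ
      w = proj₁ (inverse-mod-p^ j u-unit)
      uw≡1 : (u * w) % p ^ j ≡ 1 % p ^ j
      uw≡1 = proj₂ (inverse-mod-p^ j u-unit)
      reorder : ∀ v w u → v * w * u ≡ v * (u * w)
      reorder = solve-∀
      vw*u≡v : (v * w * u) % p ^ j ≡ v % p ^ j
      vw*u≡v = trans (cong (_% p ^ j) (reorder v w u))
        (trans (%-cong-*ˡ (p ^ j) v uw≡1) (cong (_% p ^ j) (*-identityʳ v)))
      reduces : ∀ d .{{_ : NonZero d}} r → d ∣ p ^ j → v % d ≡ (r * u) % d → (v * w) % d ≡ r % d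
      reduces d r d∣pʲ v≡ru = begin
        (v * w) % d         ≡⟨ %-cong-*ʳ d w v≡ru ⟩
        (r * u * w) % d     ≡⟨ cong (_% d) (*-assoc r u w) ⟩
        (r * (u * w)) % d   ≡⟨ %-cong-*ˡ d r (%-≡-∣ d∣pʲ uw≡1) ⟩
        (r * 1) % d         ≡⟨ cong (_% d) (*-identityʳ r) ⟩
        r % d               ∎
        where open ≡-Reasoning

    multiplier-2 : ∀ {u v} → p ≡ 2 → Unit u → u < p ^ j → v < p ^ j → u % 8 ≡ v % 8 →
                   ∃ λ c → SymbolPreserving c × (c * u) % p ^ j ≡ v % p ^ j
    multiplier-2 {u} {v} p≡2 u-unit u< v< u≡v-mod-8 with 3 ≤? j
    ... | no j≱3 = 1 , symbolPreserving-1 , cong (_% p ^ j) (trans (*-identityˡ u) u≡v)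
      where
      pʲ≤8 : p ^ j ≤ 8
      pʲ≤8 = subst (p ^ j ≤_) (cong (_^ 3) p≡2) (^-monoʳ-≤ p (<⇒≤ (≰⇒> j≱3)))
      u≡v : u ≡ v
      u≡v = trans (≡.sym (m<n⇒m%n≡m (≤-trans u< pʲ≤8))) (trans u≡v-mod-8 (m<n⇒m%n≡m (≤-trans v< pʲ≤8)))
    ... | yes 3≤j with c , cu≡v , reduces ← quotient-mod-p^ u-unit v = c , c-preserving , cu≡v
      where
      c%8≡1 : c % 8 ≡ 1
      c%8≡1 = reduces 8 1 (subst (_∣ p ^ j) (cong (_^ 3) p≡2) (^-monoʳ-∣ p 3≤j))
                (≡.sym (trans (cong (_% 8) (*-identityˡ u)) u≡v-mod-8))
      c%p≡1 : c % p ≡ 1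
      c%p≡1 = trans (%-congʳ p≡2) (trans (≡.sym (m∣n⇒o%n%m≡o%m 2 8 c (divides 4 refl))) (cong (_% 2) c%8≡1))
      c-preserving : SymbolPreserving c
      c-preserving = record
        { unit     = λ c%p≡0 → 0≢1+n (trans (≡.sym c%p≡0) c%p≡1)
        ; ≡1-mod-8 = λ _ → c%8≡1
        ; square   = λ p≢2 → ⊥-elim (p≢2 p≡2)
        }

    multiplier-odd : ∀ {u v} → 0 < j → p ≢ 2 → Unit u → Unit v → legendre u p ≡ legendre v p →
                     ∃ λ c → SymbolPreserving c × (c * u) % p ^ j ≡ v % p ^ j
    multiplier-odd {u} {v} 0<j p≢2 u-unit v-unit leg
      with z , z-unit , v≡z²u ← OddPrime.same-character⇒square-ratio p p-prime p≢2 u-unit v-unit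
                                  (Equivalence.to (legendre-≡⇔ p u-unit v-unit) leg)
         | c , cu≡v , reduces ← quotient-mod-p^ u-unit v
      = c , c-preserving , cu≡v
      where
      c≡z² : c % p ≡ (z * z) % p
      c≡z² = reduces p (z * z) (subst (_∣ p ^ j) (*-identityʳ p) (^-monoʳ-∣ p 0<j)) v≡z²u
      c-preserving : SymbolPreserving c
      c-preserving = record
        { unit     = unit-cong (≡.sym c≡z²) (unit-* z-unit z-unit)
        ; ≡1-mod-8 = λ p≡2 → ⊥-elim (p≢2 p≡2)
        ; square   = λ _ → z , z-unit , c≡z²
        }

    unitSign-≡⇒multiplier : ∀ {u v} → 0 < j → Unit u → Unit v → u < p ^ j → v < p ^ j →
      unitSign p u ≡ unitSign p v → ∃ λ c → SymbolPreserving c × (c * u) % p ^ j ≡ v % p ^ j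
    unitSign-≡⇒multiplier 0<j u-unit v-unit u< v< u≈v with p ≟ 2
    ... | yes p≡2 = multiplier-2 p≡2 u-unit u< v<
                      (ℤ.+-injective (trans (≡.sym (unitSign-2 p≡2)) (trans u≈v (unitSign-2 p≡2))))
    ... | no p≢2  = multiplier-odd 0<j p≢2 u-unit v-unit
                      (trans (≡.sym (unitSign-odd p≢2)) (trans u≈v (unitSign-odd p≢2)))

  symbolℕ-* : ∀ {x} → SymbolPreserving c → x < p ^ k → symbolℕ p ((c * x) % p ^ k) ≡ symbolℕ p x
  symbolℕ-* {c} {zero} _ _ = cong (symbolℕ p) (trans (cong (_% p ^ k) (*-zeroʳ c)) (0%n≡0 (p ^ k)))
  symbolℕ-* {c} {x@(suc _)} c-pres x< = begin
    symbolℕ p ((c * x) % p ^ k)               ≡⟨ cong (λ t → symbolℕ p ((c * t) % p ^ k)) x≡ ⟩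
    symbolℕ p ((c * (p ^ e * y)) % p ^ k)     ≡⟨ cong (symbolℕ p) (*-%-p^e {e} {j} k≡e+j c y) ⟩
    symbolℕ p (p ^ e * ((c * y) % p ^ j))     ≡⟨ symbolℕ-p^e*y p 1<p e cy%pʲ-unit ⟩
    (fin e , unitSign p ((c * y) % p ^ j))    ≡⟨ cong (fin e ,_) (unitSign-* j c-pres 0<j y-unit y<) ⟩
    (fin e , unitSign p y)                    ≡⟨ symbolℕ-p^e*y p 1<p e y-unit ⟨
    symbolℕ p (p ^ e * y)                     ≡⟨ cong (symbolℕ p) x≡ ⟨
    symbolℕ p x                               ∎
    where
    open ≡-Reasoning
    open Split (split z<s x<)
    open Modulus j
    cy%pʲ-unit : Unit ((c * y) % p ^ j)
    cy%pʲ-unit = unit-cong (≡.sym (%-p^j-%-p j 0<j (c * y))) (unit-* (SymbolPreserving.unit c-pres) y-unit)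

  symbolℕ-≡⇒multiplier : ∀ {u v} → u < p ^ k → v < p ^ k → symbolℕ p u ≡ symbolℕ p v →
                         ∃ λ c → SymbolPreserving c × (c * u) % p ^ k ≡ v
  symbolℕ-≡⇒multiplier {zero} {v} _ _ u≈v =
    1 , symbolPreserving-1 , trans (0%n≡0 (p ^ k)) (≡.sym (ord≡∞⇒≡0 p v (≡.sym (cong proj₁ u≈v))))
  symbolℕ-≡⇒multiplier {suc _} {zero} _ _ u≈v = ⊥-elim (1+n≢0 (ord≡∞⇒≡0 p _ (cong proj₁ u≈v)))
  symbolℕ-≡⇒multiplier {u@(suc _)} {v@(suc _)} u< v< u≈v = r , r-preserving , ru≡v
    where
    module U = Split (split z<s u<)
    module V = Split (split z<s v<)
    open Modulus U.j
    open ≡-Reasoning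
    symbols≡ : (fin U.e , unitSign p U.y) ≡ (fin V.e , unitSign p V.y)
    symbols≡ = begin
      (fin U.e , unitSign p U.y)   ≡⟨ symbolℕ-p^e*y p 1<p U.e U.y-unit ⟨
      symbolℕ p (p ^ U.e * U.y)    ≡⟨ cong (symbolℕ p) U.x≡ ⟨
      symbolℕ p u                  ≡⟨ u≈v ⟩
      symbolℕ p v                  ≡⟨ cong (symbolℕ p) V.x≡ ⟩
      symbolℕ p (p ^ V.e * V.y)    ≡⟨ symbolℕ-p^e*y p 1<p V.e V.y-unit ⟩
      (fin V.e , unitSign p V.y)   ∎
    e≡ : U.e ≡ V.e
    e≡ = fin-injective (cong proj₁ symbols≡)
    j≡ : V.j ≡ U.j
    j≡ = +-cancelˡ-≡ U.e V.j U.j (trans (cong (_+ V.j) e≡) (trans (≡.sym V.k≡e+j) U.k≡e+j))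
    v<pʲ : V.y < p ^ U.j
    v<pʲ = subst (λ i → V.y < p ^ i) j≡ V.y<
    multiplier : ∃ λ c → SymbolPreserving c × (c * U.y) % p ^ U.j ≡ V.y % p ^ U.j
    multiplier = unitSign-≡⇒multiplier U.j U.0<j U.y-unit V.y-unit U.y< v<pʲ (cong proj₂ symbols≡)
    r : ℕ
    r = proj₁ multiplier
    r-preserving : SymbolPreserving r
    r-preserving = proj₁ (proj₂ multiplier)
    ru≡v : (r * u) % p ^ k ≡ v
    ru≡v = begin
      (r * u) % p ^ k                       ≡⟨ cong (λ t → (r * t) % p ^ k) U.x≡ ⟩
      (r * (p ^ U.e * U.y)) % p ^ k         ≡⟨ *-%-p^e {U.e} {U.j} U.k≡e+j r U.y ⟩
      p ^ U.e * ((r * U.y) % p ^ U.j)       ≡⟨ cong (p ^ U.e *_) (proj₂ (proj₂ multiplier)) ⟩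
      p ^ U.e * (V.y % p ^ U.j)             ≡⟨ cong (p ^ U.e *_) (m<n⇒m%n≡m v<pʲ) ⟩
      p ^ U.e * V.y                         ≡⟨ cong (λ i → p ^ i * V.y) e≡ ⟩
      p ^ V.e * V.y                         ≡⟨ V.x≡ ⟨
      v                                     ∎

  -- Multiplication by c on the residues {0, …, p^k − 1}, extended by the identity so that it is a
  -- bijection of ℕ whenever c is invertible modulo p^k.
  scale : ℕ → ℕ → ℕ
  scale c x with x <? p ^ k
  ... | yes _ = (c * x) % p ^ k
  ... | no  _ = x

  scale-< : ∀ {x} → x < p ^ k → scale c x ≡ (c * x) % p ^ k
  scale-< {c} {x} x< with x <? p ^ k
  ... | yes _ = refl
  ... | no x≮ = ⊥-elim (x≮ x<)

  scale-≮ : ∀ {x} → ¬ x < p ^ k → scale c x ≡ x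
  scale-≮ {c} {x} x≮ with x <? p ^ k
  ... | yes x< = ⊥-elim (x≮ x<)
  ... | no _   = refl

  scale<p^k : ∀ {x} → x < p ^ k → scale c x < p ^ k
  scale<p^k {c} {x} x< = subst (_< p ^ k) (≡.sym (scale-< x<)) (m%n<n (c * x) (p ^ k))

  *-%-inverse : ∀ {c c′ x} → (c * c′) % p ^ k ≡ 1 % p ^ k → x < p ^ k → (c′ * ((c * x) % p ^ k)) % p ^ k ≡ x
  *-%-inverse {c} {c′} {x} cc′≡1 x< = begin
    (c′ * ((c * x) % p ^ k)) % p ^ k   ≡⟨ %-cong-*ˡ (p ^ k) c′ (m%n%n≡m%n (c * x) (p ^ k)) ⟩
    (c′ * (c * x)) % p ^ k             ≡⟨ cong (_% p ^ k) (reorder c′ c x) ⟩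
    ((c * c′) * x) % p ^ k             ≡⟨ %-cong-*ʳ (p ^ k) x cc′≡1 ⟩
    (1 * x) % p ^ k                    ≡⟨ cong (_% p ^ k) (*-identityˡ x) ⟩
    x % p ^ k                          ≡⟨ m<n⇒m%n≡m x< ⟩
    x                                  ∎
    where
    open ≡-Reasoning
    reorder : ∀ c′ c x → c′ * (c * x) ≡ (c * c′) * x
    reorder = solve-∀

  scale-inverse : ∀ {c c′} → (c * c′) % p ^ k ≡ 1 % p ^ k → ∀ x → scale c′ (scale c x) ≡ x
  scale-inverse {c} {c′} cc′≡1 x with x <? p ^ k
  ... | yes x< = trans (scale-< (m%n<n (c * x) (p ^ k))) (*-%-inverse {c} {c′} cc′≡1 x<)
  ... | no x≮  = scale-≮ x≮

  sym-scale : SymbolPreserving c → ∀ {a} → a < p ^ k → sym p k (ℤ.+ scale c a) ≡ sym p k (ℤ.+ a)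
  sym-scale {c} c-pres {a} a< = begin
    sym p k (ℤ.+ scale c a)         ≡⟨ cong (symbolℕ p) (modℤ-+ (scale c a) (p ^ k)) ⟩
    symbolℕ p (scale c a % p ^ k)   ≡⟨ cong (symbolℕ p) (m<n⇒m%n≡m (scale<p^k a<)) ⟩
    symbolℕ p (scale c a)           ≡⟨ cong (symbolℕ p) (scale-< a<) ⟩
    symbolℕ p ((c * a) % p ^ k)     ≡⟨ symbolℕ-* c-pres a< ⟩
    symbolℕ p a                     ≡⟨ cong (symbolℕ p) (trans (modℤ-+ a (p ^ k)) (m<n⇒m%n≡m a<)) ⟨
    sym p k (ℤ.+ a)                 ∎
    where open ≡-Reasoning

  scale-+ : a < p ^ k → b < p ^ k → (scale c a + scale c b) % p ^ k ≡ (c * ((a + b) % p ^ k)) % p ^ k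
  scale-+ {a} {b} {c} a< b< = begin
    (scale c a + scale c b) % p ^ k                 ≡⟨ cong₂ (λ x y → (x + y) % p ^ k) (scale-< a<) (scale-< b<) ⟩
    ((c * a) % p ^ k + (c * b) % p ^ k) % p ^ k
      ≡⟨ %-cong-+ (p ^ k) (m%n%n≡m%n (c * a) (p ^ k)) (m%n%n≡m%n (c * b) (p ^ k)) ⟩
    (c * a + c * b) % p ^ k                         ≡⟨ cong (_% p ^ k) (*-distribˡ-+ c a b) ⟨
    (c * (a + b)) % p ^ k                           ≡⟨ %-cong-*ˡ (p ^ k) c (m%n%n≡m%n (a + b) (p ^ k)) ⟨
    (c * ((a + b) % p ^ k)) % p ^ k                 ∎
    where open ≡-Reasoning

  scale-+-≡⇔ : ∀ {c c′ u} → (c * c′) % p ^ k ≡ 1 % p ^ k → u < p ^ k → a < p ^ k → b < p ^ k →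
               (a + b) % p ^ k ≡ u ⇔ (scale c a + scale c b) % p ^ k ≡ (c * u) % p ^ k
  scale-+-≡⇔ {a} {b} {c} {c′} {u} cc′≡1 u< a< b< = mk⇔
    (λ a+b≡u → trans (scale-+ a< b<) (cong (λ x → (c * x) % p ^ k) a+b≡u))
    (λ e → begin
      (a + b) % p ^ k                              ≡⟨ *-%-inverse {c} {c′} cc′≡1 (m%n<n (a + b) (p ^ k)) ⟨
      (c′ * ((c * ((a + b) % p ^ k)) % p ^ k)) % p ^ k
                                                   ≡⟨ cong (λ x → (c′ * x) % p ^ k) (trans (≡.sym (scale-+ a< b<)) e) ⟩
      (c′ * ((c * u) % p ^ k)) % p ^ k             ≡⟨ *-%-inverse {c} {c′} cc′≡1 u< ⟩
      u                                            ∎)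
    where open ≡-Reasoning

  InS-scale⇔ : ∀ {c c′ t s γ₁ γ₂} → SymbolPreserving c → (c * c′) % p ^ k ≡ 1 % p ^ k →
               (c * modℤ t (p ^ k)) % p ^ k ≡ modℤ s (p ^ k) → a < p ^ k → b < p ^ k →
               InS p k t γ₁ γ₂ (a , b) ⇔ InS p k s γ₁ γ₂ (scale c a , scale c b)
  InS-scale⇔ {a} {b} {c} {c′} {t} {s} c-pres cc′≡1 ct≡s a< b< = mk⇔
    (λ (γa , γb , sum≡t) → trans (sym-scale c-pres a<) γa , trans (sym-scale c-pres b<) γb ,
      trans (modℤ-+ _ (p ^ k)) (trans (Equivalence.to sum⇔ (trans (≡.sym (modℤ-+ _ (p ^ k))) sum≡t)) ct≡s))
    (λ (γa , γb , sum≡s) → trans (≡.sym (sym-scale c-pres a<)) γa , trans (≡.sym (sym-scale c-pres b<)) γb ,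
      trans (modℤ-+ _ (p ^ k))
            (Equivalence.from sum⇔ (trans (≡.sym (modℤ-+ _ (p ^ k))) (trans sum≡s (≡.sym ct≡s)))))
    where
    sum⇔ : (a + b) % p ^ k ≡ modℤ t (p ^ k) ⇔ (scale c a + scale c b) % p ^ k ≡ (c * modℤ t (p ^ k)) % p ^ k
    sum⇔ = scale-+-≡⇔ {c′ = c′} cc′≡1 (modℤ< t (p ^ k)) a< b<

  residuePairs : List (ℕ × ℕ)
  residuePairs = cartesianProduct (upTo (p ^ k)) (upTo (p ^ k))

  ∈-residuePairs⁻ : (a , b) ∈ residuePairs → a < p ^ k × b < p ^ k
  ∈-residuePairs⁻ ab∈ = Product.map ∈-upTo⁻ ∈-upTo⁻ (∈-cartesianProduct⁻ (upTo (p ^ k)) (upTo (p ^ k)) ab∈)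

  scale-∈-residuePairs : ∀ c {ab} → ab ∈ residuePairs → Product.map (scale c) (scale c) ab ∈ residuePairs
  scale-∈-residuePairs c ab∈ with a< , b< ← ∈-residuePairs⁻ ab∈ =
    ∈-cartesianProduct⁺ (∈-upTo⁺ (scale<p^k a<)) (∈-upTo⁺ (scale<p^k b<))

  cardS-≡ : ∀ {c t s γ₁ γ₂} → SymbolPreserving c → (c * modℤ t (p ^ k)) % p ^ k ≡ modℤ s (p ^ k) →
            cardS p k t γ₁ γ₂ ≡ cardS p k s γ₁ γ₂
  cardS-≡ {c} {t} {s} {γ₁} {γ₂} c-pres ct≡s =
    length-filter-bijection (InS? p k t γ₁ γ₂) (InS? p k s γ₁ γ₂) residuePairs
      (Unique.cartesianProduct⁺ (Unique.upTo⁺ (p ^ k)) (Unique.upTo⁺ (p ^ k)))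
      (Product.map (scale c) (scale c)) (Product.map (scale c′) (scale c′))
      (λ (a , b) → cong₂ _,_ (scale-inverse cc′≡1 a) (scale-inverse cc′≡1 b))
      (λ (a , b) → cong₂ _,_ (scale-inverse c′c≡1 a) (scale-inverse c′c≡1 b))
      (scale-∈-residuePairs c) (scale-∈-residuePairs c′)
      (λ ab∈ → let a< , b< = ∈-residuePairs⁻ ab∈ in InS-scale⇔ c-pres cc′≡1 ct≡s a< b<)
    where
    c′ : ℕ
    c′ = proj₁ (inverse-mod-p^ k (SymbolPreserving.unit c-pres))
    cc′≡1 : (c * c′) % p ^ k ≡ 1 % p ^ k
    cc′≡1 = proj₂ (inverse-mod-p^ k (SymbolPreserving.unit c-pres))
    c′c≡1 : (c′ * c) % p ^ k ≡ 1 % p ^ k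
    c′c≡1 = trans (cong (_% p ^ k) (*-comm c′ c)) cc′≡1

lemma6 : (p k : ℕ) → Prime p → 1 ≤ k →
         (γ₁ γ₂ : Symbol) → IsSymbol p k γ₁ → IsSymbol p k γ₂ →
         (t s : ℤ) → sym p k t ≡ sym p k s →
         cardS p k t γ₁ γ₂ ≡ cardS p k s γ₁ γ₂
lemma6 p k p-prime _ γ₁ γ₂ _ _ t s t≈s =
  let c , c-preserving , ct≡s = symbolℕ-≡⇒multiplier (modℤ< t (p ^ k)) (modℤ< s (p ^ k)) t≈s
  in  cardS-≡ c-preserving ct≡s
  where
  open PrimePower p p-prime k
  open Units.Modulus p p-prime k
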